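{- Let $P_1,P_2$ be processes each satisfying \texttt{positive bid-ask spread}, \texttt{price-time priority} and \texttt{conservation}. Then for every structured order book $\mathcal I$ and every natural number $k$, if $\mathsf{Iterated}(P_1,\mathcal I,k)=(B_1,A_1,M_1)$ and $\mathsf{Iterated}(P_2,\mathcal I,k)=(B_2,A_2,M_2)$, then $(B_1,A_1,\mathcal C(M_1))=(B_2,A_2,\mathcal C(M_2))$.
   Context: An order is a 4-tuple $\omega=(\mathsf{id}(\omega),\mathsf{timestamp}(\omega),\mathsf{qty}(\omega),\mathsf{price}(\omega))$ of natural numbers with $\mathsf{qty}(\omega)>0$; $\mathsf{ids}(S)$ is the set of ids of orders in $S$. An order-domain is a pair $(B,A)$ of finite sets of orders ($B$ = bids, $A$ = asks); it is admissible if all orders in $B\cup A$ have pairwise distinct ids and pairwise distinct timestamps. A bid $b$ and ask $a$ are tradable if $\mathsf{price}(b)\ge\mathsf{price}(a)$; $(B,A)$ is matchable if some $b\in B$, $a\in A$ are tradable. Competitiveness: bid $b_1\succ b_2$ iff $\mathsf{price}(b_1)>\mathsf{price}(b_2)$, or prices equal and $\mathsf{timestamp}(b_1)<\mathsf{timestamp}(b_2)$; ask $a_1\succ a_2$ iff $\mathsf{price}(a_1)<\mathsf{price}(a_2)$, or prices equal and $\mathsf{timestamp}(a_1)<\mathsf{timestamp}(a_2)$. A transaction is a triple $t=(\mathsf{id_{bid}}(t),\mathsf{id_{ask}}(t),\mathsf{qty}(t))$ of natural numbers with $\mathsf{qty}(t)>0$. It is valid w.r.t. $(B,A)$ if there are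 $b\in B$, $a\in A$ with $\mathsf{id_{bid}}(t)=\mathsf{id}(b)$, $\mathsf{id_{ask}}(t)=\mathsf{id}(a)$, $b,a$ tradable, and $\mathsf{qty}(t)\le\min(\mathsf{qty}(b),\mathsf{qty}(a))$. For a finite set of transactions $T$, $\mathsf{Qty}(T,id)$ is the sum of quantities of transactions in $T$ whose bid id (for a bid) resp. ask id (for an ask) equals $id$; $\mathsf{ids_{bid}}(T),\mathsf{ids_{ask}}(T)$ are the sets of bid/ask ids occurring in $T$. A matching over an admissible $(B,A)$ is a set $M$ of transactions valid w.r.t. $(B,A)$ with $\mathsf{Qty}(M,\mathsf{id}(\omega))\le\mathsf{qty}(\omega)$ for all $\omega\in B\cup A$. The canonical form $\mathcal C(M)$ is the set of transactions containing, for each bid id/ask id pair with positive total quantity in $M$, exactly one transaction between them whose quantity equals that total (and nothing else). $\mathsf{Bids}(M,B)$ is the set of bids of $B$ occurring in $M$ with quantity replaced by $\mathsf{Qty}(M,\mathsf{id}(b))$; $\mathsf{Asks}(M,A)$ likewise. Sets of orders are viewed as multisets where each order (quantity field suppressed) has multiplicity equal to its quantity; $S_1-S_2$ is multiset difference. An instruction is a pair $(\Delta,\omega)$ with command $\Delta\in\{\mathsf{Buy},\mathsf{Sell},\mathsf{Del}\}$ and an order $\omega$. $\mathsf{Absorb}(B,A,(\mathsf{Del},\omega))=(\{b\in B:\mathsf{id}(b)\ne\mathsf{id}(\omega)\},\{a\in A:\mathsf{id}(a)\ne\mathsf{id}(\omega)\})$, $\mathsf{Absorb}(B,A,(\mathsf{Buy},\beta))=(B\cup\{\beta\},A)$,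 $\mathsf{Absorb}(B,A,(\mathsf{Sell},\alpha))=(B,A\cup\{\alpha\})$. $((B,A),\tau)$ is a legal-input if $(B,A)$ is not matchable and $\mathsf{Absorb}(B,A,\tau)$ is admissible. A process is a function $P:(B,A,\tau)\mapsto(\hat B,\hat A,M)$. For every legal-input $((B,A),\tau)$ with $P(B,A,\tau)=(\hat B,\hat A,M)$ and $(B',A')=\mathsf{Absorb}(B,A,\tau)$, $P$ satisfies: \texttt{positive bid-ask spread} if $(\hat B,\hat A)$ is not matchable; \texttt{price-time priority} if for all $a,a'\in A'$ with $a\succ a'$ and $\mathsf{id}(a')\in\mathsf{ids_{ask}}(M)$ we have $\mathsf{Qty}(M,\mathsf{id}(a))=\mathsf{qty}(a)$, and for all $b,b'\in B'$ with $b\succ b'$ and $\mathsf{id}(b')\in\mathsf{ids_{bid}}(M)$ we have $\mathsf{Qty}(M,\mathsf{id}(b))=\mathsf{qty}(b)$; \texttt{conservation} if $M$ is a matching over $(B',A')$, $\hat B=B'-\mathsf{Bids}(M,B')$ and $\hat A=A'-\mathsf{Asks}(M,A')$. A process satisfies a property if it does so for all legal-inputs. An order book is a list $\mathcal I=[(\Delta_0,\omega_0),\dots,(\Delta_n,\omega_n)]$ of instructions. It is structured if (i) $\mathsf{timestamp}(\omega_i)<\mathsf{timestamp}(\omega_{i+1})$ for all $0\le i<n$, and (ii) for every $0\le i\le n$, at least one holds: $\Delta_i=\mathsf{Del}$; or $\mathsf{id}(\omega_i)\notin\mathsf{ids}\{\omega_0,\dots,\omega_{i-1}\}$; or ($i\ge1$,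 $\mathsf{id}(\omega_i)=\mathsf{id}(\omega_{i-1})$ and $\Delta_{i-1}=\mathsf{Del}$). $\mathsf{Iterated}(P,\mathcal I,k)$ is defined by: $\mathsf{Iterated}(P,\mathcal I,0)=(\emptyset,\emptyset,\emptyset)$; for $1\le k\le n+1$, if $\mathsf{Iterated}(P,\mathcal I,k-1)=(B,A,M)$ then $\mathsf{Iterated}(P,\mathcal I,k)=P(B,A,(\Delta_{k-1},\omega_{k-1}))$; for $k>n+1$, $\mathsf{Iterated}(P,\mathcal I,k)=(\emptyset,\emptyset,\emptyset)$. -}

module Defs where

open import Data.Nat using (ℕ; zero; suc; _+_; _∸_; _≤_; _<_; _≟_; _<?_)
open import Data.Nat.Properties using (≤-irrelevant)
open import Data.Nat.ListAction using (sum)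
open import Data.List using (List; []; _∷_; _++_; map; filter; deduplicate; mapMaybe; take; length)
open import Data.List.Membership.Propositional using (_∈_; _∉_)
open import Data.List.Relation.Binary.BagAndSetEquality using (_∼[_]_; set)
open import Data.Maybe using (Maybe; just; nothing)
open import Data.Product using (Σ; ∃; ∃-syntax; _×_; _,_; proj₁; proj₂)
open import Data.Sum using (_⊎_)
open import Relation.Nullary using (¬_; Dec; yes; no)
open import Relation.Nullary.Decidable using (¬?; _×-dec_)
open import Relation.Binary.PropositionalEquality using (_≡_; _≢_; refl; cong)
open import Relation.Binary.Definitions using (DecidableEquality)

-- An order (id, timestamp, qty, price) with qty > 0.
-- The positivity proof is an irrelevant field, so two orders are equal
-- iff their four numeric components are equal.
record Order : Set where
  constructor mkOrder
  field
    id        : ℕ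
    timestamp : ℕ
    qty       : ℕ
    price     : ℕ
    .qty>0    : 0 < qty
open Order public

record Transaction : Set where
  constructor mkTrans
  field
    idBid  : ℕ
    idAsk  : ℕ
    tqty   : ℕ
    .tqty>0 : 0 < tqty
open Transaction public

_≟ᵒ_ : DecidableEquality Order
mkOrder i t q p _ ≟ᵒ mkOrder i' t' q' p' _ with i ≟ i' | t ≟ t' | q ≟ q' | p ≟ p'
... | yes refl | yes refl | yes refl | yes refl = yes refl
... | no ne | _ | _ | _ = no (λ e → ne (cong id e))
... | yes _ | no ne | _ | _ = no (λ e → ne (cong timestamp e))
... | yes _ | yes _ | no ne | _ = no (λ e → ne (cong qty e))
... | yes _ | yes _ | yes _ | no ne = no (λ e → ne (cong price e))

_≟ᵗ_ : DecidableEquality Transaction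
mkTrans i j q _ ≟ᵗ mkTrans i' j' q' _ with i ≟ i' | j ≟ j' | q ≟ q'
... | yes refl | yes refl | yes refl = yes refl
... | no ne | _ | _ = no (λ e → ne (cong idBid e))
... | yes _ | no ne | _ = no (λ e → ne (cong idAsk e))
... | yes _ | yes _ | no ne = no (λ e → ne (cong tqty e))

-- Finite sets are represented by lists, read as sets: duplicates are
-- irrelevant (all sums below are over the deduplicated list) and
-- equality of finite sets is set equality `_≈ˢ_` (same members).

OrderSet : Set
OrderSet = List Order

TransSet : Set
TransSet = List Transaction

_≈ˢ_ : {A : Set} → List A → List A → Set
xs ≈ˢ ys = xs ∼[ set ] ys

dedupO : OrderSet → OrderSet
dedupO = deduplicate _≟ᵒ_

dedupT : TransSet → TransSet
dedupT = deduplicate _≟ᵗ_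

ids : OrderSet → List ℕ
ids S = map id S

Admissible : OrderSet → OrderSet → Set
Admissible B A =
  ∀ o o' → o ∈ B ++ A → o' ∈ B ++ A → o ≢ o' →
    (id o ≢ id o') × (timestamp o ≢ timestamp o')

Tradable : Order → Order → Set
Tradable b a = price a ≤ price b

Matchable : OrderSet → OrderSet → Set
Matchable B A = ∃[ b ] ∃[ a ] (b ∈ B × a ∈ A × Tradable b a)

_≻bid_ : Order → Order → Set
b₁ ≻bid b₂ = (price b₂ < price b₁) ⊎ (price b₁ ≡ price b₂ × timestamp b₁ < timestamp b₂)

_≻ask_ : Order → Order → Set
a₁ ≻ask a₂ = (price a₁ < price a₂) ⊎ (price a₁ ≡ price a₂ × timestamp a₁ < timestamp a₂)

ValidTrans : Transaction → OrderSet → OrderSet → Set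
ValidTrans t B A = ∃[ b ] ∃[ a ]
  (b ∈ B × a ∈ A × idBid t ≡ id b × idAsk t ≡ id a × Tradable b a
   × tqty t ≤ qty b × tqty t ≤ qty a)

QtyBid : TransSet → ℕ → ℕ
QtyBid T i = sum (map tqty (filter (λ t → idBid t ≟ i) (dedupT T)))

QtyAsk : TransSet → ℕ → ℕ
QtyAsk T i = sum (map tqty (filter (λ t → idAsk t ≟ i) (dedupT T)))

idsBid : TransSet → List ℕ
idsBid T = map idBid T

idsAsk : TransSet → List ℕ
idsAsk T = map idAsk T

-- M is a matching over (B, A)  (admissibility of (B, A) is assumed where used)
Matching : TransSet → OrderSet → OrderSet → Set
Matching M B A =
  (∀ t → t ∈ M → ValidTrans t B A)
  × (∀ b → b ∈ B → QtyBid M (id b) ≤ qty b)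
  × (∀ a → a ∈ A → QtyAsk M (id a) ≤ qty a)

PairQty : TransSet → ℕ → ℕ → ℕ
PairQty M i j = sum (map tqty (filter (λ t → (idBid t ≟ i) ×-dec (idAsk t ≟ j)) (dedupT M)))

canonical : TransSet → TransSet
canonical M = dedupT (mapMaybe mk M)
  where
  mk : Transaction → Maybe Transaction
  mk t with 0 <? PairQty M (idBid t) (idAsk t)
  ... | yes p = just (mkTrans (idBid t) (idAsk t) (PairQty M (idBid t) (idAsk t)) p)
  ... | no _  = nothing

Bids : TransSet → OrderSet → OrderSet
Bids M B = mapMaybe mk B
  where
  mk : Order → Maybe Order
  mk b with 0 <? QtyBid M (id b)
  ... | yes p = just (mkOrder (id b) (timestamp b) (QtyBid M (id b)) (price b) p)
  ... | no _  = nothing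

Asks : TransSet → OrderSet → OrderSet
Asks M A = mapMaybe mk A
  where
  mk : Order → Maybe Order
  mk a with 0 <? QtyAsk M (id a)
  ... | yes p = just (mkOrder (id a) (timestamp a) (QtyAsk M (id a)) (price a) p)
  ... | no _  = nothing

-- Multiset view: an order with its quantity suppressed, i.e. the key
-- (id, timestamp, price), has multiplicity = its quantity.

Key : Set
Key = ℕ × ℕ × ℕ

key : Order → Key
key o = id o , timestamp o , price o

_≟ᵏ_ : DecidableEquality Key
(i , t , p) ≟ᵏ (i' , t' , p') with i ≟ i' | t ≟ t' | p ≟ p'
... | yes refl | yes refl | yes refl = yes refl
... | no ne | _ | _ = no (λ e → ne (cong proj₁ e))
... | yes _ | no ne | _ = no (λ e → ne (cong (λ x → proj₁ (proj₂ x)) e))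
... | yes _ | yes _ | no ne = no (λ e → ne (cong (λ x → proj₂ (proj₂ x)) e))

mult : OrderSet → Key → ℕ
mult S k = sum (map qty (filter (λ o → key o ≟ᵏ k) (dedupO S)))

-- multiset difference S₁ - S₂, turned back into a set of orders:
-- each key with positive multiplicity m becomes one order of quantity m
_−ᵐ_ : OrderSet → OrderSet → OrderSet
S₁ −ᵐ S₂ = mapMaybe mk (deduplicate _≟ᵏ_ (map key S₁))
  where
  mk : Key → Maybe Order
  mk (i , t , p) with 0 <? (mult S₁ (i , t , p) ∸ mult S₂ (i , t , p))
  ... | yes q = just (mkOrder i t (mult S₁ (i , t , p) ∸ mult S₂ (i , t , p)) p q)
  ... | no _  = nothing

data Command : Set where
  Buy Sell Del : Command

Instruction : Set
Instruction = Command × Order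

Absorb : OrderSet → OrderSet → Instruction → OrderSet × OrderSet
Absorb B A (Del , ω) =
  filter (λ b → ¬? (id b ≟ id ω)) B , filter (λ a → ¬? (id a ≟ id ω)) A
Absorb B A (Buy , β) = β ∷ B , A
Absorb B A (Sell , α) = B , α ∷ A

LegalInput : OrderSet → OrderSet → Instruction → Set
LegalInput B A τ =
  ¬ Matchable B A × Admissible (proj₁ (Absorb B A τ)) (proj₂ (Absorb B A τ))

Process : Set
Process = OrderSet → OrderSet → Instruction → OrderSet × OrderSet × TransSet

PositiveBidAskSpread : Process → Set
PositiveBidAskSpread P = ∀ B A τ → LegalInput B A τ →
  ¬ Matchable (proj₁ (P B A τ)) (proj₁ (proj₂ (P B A τ)))

PriceTimePriority : Process → Set
PriceTimePriority P = ∀ B A τ → LegalInput B A τ →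
  let B' = proj₁ (Absorb B A τ)
      A' = proj₂ (Absorb B A τ)
      M  = proj₂ (proj₂ (P B A τ))
  in (∀ a a' → a ∈ A' → a' ∈ A' → a ≻ask a' → id a' ∈ idsAsk M → QtyAsk M (id a) ≡ qty a)
     × (∀ b b' → b ∈ B' → b' ∈ B' → b ≻bid b' → id b' ∈ idsBid M → QtyBid M (id b) ≡ qty b)

Conservation : Process → Set
Conservation P = ∀ B A τ → LegalInput B A τ →
  let B' = proj₁ (Absorb B A τ)
      A' = proj₂ (Absorb B A τ)
      B̂  = proj₁ (P B A τ)
      Â  = proj₁ (proj₂ (P B A τ))
      M  = proj₂ (proj₂ (P B A τ))
  in Matching M B' A' × (B̂ ≈ˢ (B' −ᵐ Bids M B')) × (Â ≈ˢ (A' −ᵐ Asks M A'))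

OrderBook : Set
OrderBook = List Instruction

nth : {A : Set} → List A → ℕ → Maybe A
nth []       _       = nothing
nth (x ∷ xs) zero    = just x
nth (x ∷ xs) (suc i) = nth xs i

Structured : OrderBook → Set
Structured I =
  (∀ i Δ ω Δ' ω' → nth I i ≡ just (Δ , ω) → nth I (suc i) ≡ just (Δ' , ω') →
     timestamp ω < timestamp ω')
  × (∀ i Δ ω → nth I i ≡ just (Δ , ω) →
       (Δ ≡ Del)
       ⊎ (id ω ∉ map (λ τ → id (proj₂ τ)) (take i I))
       ⊎ (∃[ j ] ∃[ ω' ] (i ≡ suc j × nth I j ≡ just (Del , ω') × id ω ≡ id ω')))

Iterated : Process → OrderBook → ℕ → OrderSet × OrderSet × TransSet
Iterated P I zero = [] , [] , []
Iterated P I (suc k) with nth I k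
... | nothing = [] , [] , []
... | just τ  = P (proj₁ (Iterated P I k)) (proj₁ (proj₂ (Iterated P I k))) τ

{-# OPTIONS --with-K #-}
-- By induction on k it suffices that one step of two such processes, run on set-equal states
-- reached along a structured order book, yields set-equal results. Reachable states are
-- unmatchable and admissible, and every incoming order is fresh, so each step is a legal input.
-- A deletion trades nothing. An incoming order ω sweeps the opposite side R of the book, and the
-- quantities traded with the orders of R form a greedy fill: they total at most qty ω, never
-- exceed an order's quantity, fill more competitive orders first, and leave a tradable order
-- partially filled only if ω is used up (otherwise both residuals would stay in a matchable book).
-- Greedy fills are unique: at the most competitive order where two of them differ, the smaller
-- one is used up although it fills pointwise less than the other. Conservation then determines
-- the remaining book and the canonical form of the trades from these quantities.
module Submission where

open import Defs
open import Data.Empty using (⊥; ⊥-elim)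
open import Data.List using (List; []; _∷_; _++_; map; filter; deduplicate; mapMaybe; take; length)
open import Data.List.Membership.Propositional using (_∈_; _∉_)
open import Data.List.Membership.Propositional.Properties
open import Data.List.Membership.Propositional.Properties.WithK using (unique∧set⇒bag)
open import Data.List.Properties using (filter-none; filter-all; filter-accept; filter-reject; filter-notAll; map-cong-local)
open import Data.List.Relation.Binary.BagAndSetEquality using (set; [_]-Equality; ∼bag⇒↭; ∷-cong)
open import Data.List.Relation.Binary.Permutation.Propositional.Properties using (∈-resp-↭; shift) renaming (map⁺ to ↭-map⁺)
open import Data.List.Relation.Binary.Subset.Propositional using (_⊆_)
open import Data.List.Relation.Unary.All as All using (_∷_)
open import Data.List.Relation.Unary.AllPairs using (_∷_)
open import Data.List.Relation.Unary.Any as Any using (here; there)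
open import Data.List.Relation.Unary.Unique.Propositional using (Unique)
import Data.List.Relation.Unary.Unique.DecPropositional.Properties as DecUnique
import Data.List.Relation.Unary.Unique.Propositional.Properties as Unique
open import Data.Maybe using (Maybe; just; nothing)
open import Data.Nat using (ℕ; zero; suc; _+_; _∸_; _≤_; _<_; _>_; _≟_; _<?_; z≤n; z<s)
open import Data.Nat.Induction using (<-wellFounded)
open import Data.Nat.ListAction using (sum)
open import Data.Nat.ListAction.Properties using (sum-↭)
open import Data.Nat.Properties
open import Algebra.Properties.CommutativeSemigroup +-commutativeSemigroup using (interchange)
open import Data.List.Membership.DecPropositional _≟_ using (_∈?_)
open import Data.Product using (∃-syntax; _×_; _,_; proj₁; proj₂)
open import Data.Sum using (_⊎_; inj₁; inj₂)
open import Function using (_∘_)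
open import Function.Bundles using (Equivalence; mk⇔)
import Induction.WellFounded as WF
open import Level using (0ℓ)
open import Relation.Binary.Bundles using (Setoid)
open import Relation.Binary.Consequences using (tri⇒dec<; tri⇒irr)
import Relation.Binary.Construct.On as On
open import Relation.Binary.Definitions using (DecidableEquality; Transitive; Trichotomous; tri<; tri≈; tri>)
open import Relation.Binary.PropositionalEquality using (_≡_; _≢_; refl; sym; trans; cong; cong₂; subst; module ≡-Reasoning)
open import Relation.Nullary using (¬_; Dec; yes; no; contradiction)
open import Relation.Nullary.Decidable using (recompute; ¬?; _×-dec_; _⊎-dec_)
open import Relation.Unary using (Pred; Decidable)

module ≈ˢ {X : Set} = Setoid ([ set ]-Equality X)

module _ {X : Set} {xs ys : List X} where

  ≈ˢ⇒⊆ : xs ≈ˢ ys → xs ⊆ ys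
  ≈ˢ⇒⊆ e = Equivalence.to e

  ≈ˢ⇒⊇ : xs ≈ˢ ys → ys ⊆ xs
  ≈ˢ⇒⊇ e = Equivalence.from e

  ⊆∧⊇⇒≈ˢ : xs ⊆ ys → ys ⊆ xs → xs ≈ˢ ys
  ⊆∧⊇⇒≈ˢ to from = mk⇔ to from

filter-≈ˢ : {X : Set} {P : Pred X 0ℓ} (P? : Decidable P) {xs ys : List X} → xs ≈ˢ ys → filter P? xs ≈ˢ filter P? ys
filter-≈ˢ P? xs≈ys = ⊆∧⊇⇒≈ˢ (λ x∈ → let (x∈xs , px) = ∈-filter⁻ P? x∈ in ∈-filter⁺ P? (≈ˢ⇒⊆ xs≈ys x∈xs) px)
                           (λ x∈ → let (x∈ys , px) = ∈-filter⁻ P? x∈ in ∈-filter⁺ P? (≈ˢ⇒⊇ xs≈ys x∈ys) px)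

module _ {X Y : Set} {f : X → Maybe Y} where

  ∈-mapMaybe⁻ : ∀ xs {y} → y ∈ mapMaybe f xs → ∃[ x ] (x ∈ xs × f x ≡ just y)
  ∈-mapMaybe⁻ (x ∷ xs) y∈ with f x in fx≡
  ... | nothing = let (x' , x'∈ , e) = ∈-mapMaybe⁻ xs y∈ in x' , there x'∈ , e
  ∈-mapMaybe⁻ (x ∷ xs) (here refl)  | just _ = x , here refl , fx≡
  ∈-mapMaybe⁻ (x ∷ xs) (there y∈) | just _ =
    let (x' , x'∈ , e) = ∈-mapMaybe⁻ xs y∈ in x' , there x'∈ , e

  ∈-mapMaybe⁺ : ∀ {xs x y} → x ∈ xs → f x ≡ just y → y ∈ mapMaybe f xs
  ∈-mapMaybe⁺ {x ∷ _} (here refl) fx≡ rewrite fx≡ = here refl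
  ∈-mapMaybe⁺ {x' ∷ _} (there x∈) fx≡ with f x'
  ... | just _  = there (∈-mapMaybe⁺ x∈ fx≡)
  ... | nothing = ∈-mapMaybe⁺ x∈ fx≡

module _ {X : Set} where

  sum-map-cong : (f g : X → ℕ) (xs : List X) → (∀ x → x ∈ xs → f x ≡ g x) → sum (map f xs) ≡ sum (map g xs)
  sum-map-cong f g xs f≡g = cong sum (map-cong-local (All.tabulate (λ {x} → f≡g x)))

  sum-map-≤ : (f g : X → ℕ) (xs : List X) → (∀ x → x ∈ xs → f x ≤ g x) → sum (map f xs) ≤ sum (map g xs)
  sum-map-≤ f g []       f≤g = ≤-refl
  sum-map-≤ f g (x ∷ xs) f≤g = +-mono-≤ (f≤g x (here refl)) (sum-map-≤ f g xs (λ y → f≤g y ∘ there))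

  sum-map-< : (f g : X → ℕ) (xs : List X) → (∀ x → x ∈ xs → f x ≤ g x) →
              ∀ {v} → v ∈ xs → f v < g v → sum (map f xs) < sum (map g xs)
  sum-map-< f g (x ∷ xs) f≤g (here refl) fv<gv = +-mono-<-≤ fv<gv (sum-map-≤ f g xs (λ y → f≤g y ∘ there))
  sum-map-< f g (x ∷ xs) f≤g (there v∈)  fv<gv = +-mono-≤-< (f≤g x (here refl)) (sum-map-< f g xs (λ y → f≤g y ∘ there) v∈ fv<gv)

  sum-map-+ : (f g : X → ℕ) (xs : List X) → sum (map (λ x → f x + g x) xs) ≡ sum (map f xs) + sum (map g xs)
  sum-map-+ f g []       = refl
  sum-map-+ f g (x ∷ xs) rewrite sum-map-+ f g xs = interchange (f x) (g x) (sum (map f xs)) (sum (map g xs))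

  sum-map-0 : (f : X → ℕ) (xs : List X) → (∀ x → x ∈ xs → f x ≡ 0) → sum (map f xs) ≡ 0
  sum-map-0 f []       f≡0 = refl
  sum-map-0 f (x ∷ xs) f≡0 = cong₂ _+_ (f≡0 x (here refl)) (sum-map-0 f xs (λ y → f≡0 y ∘ there))

sum-map-single : (f : ℕ → ℕ) {v : ℕ} (js : List ℕ) → Unique js → v ∈ js →
                 (∀ j → j ≢ v → f j ≡ 0) → sum (map f js) ≡ f v
sum-map-single f (j ∷ js) (j∉js ∷ _) (here refl) off =
  trans (cong (f j +_) (sum-map-0 f js (λ k k∈ → off k (λ k≡j → All.lookup j∉js k∈ (sym k≡j)))))
        (+-identityʳ (f j))
sum-map-single f (j ∷ js) (j∉js ∷ u) (there v∈) off =
  cong₂ _+_ (off j (λ j≡v → All.lookup j∉js v∈ j≡v)) (sum-map-single f js u v∈ off)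

module _ {X : Set} (g h : X → ℕ) where

  sumAt : List X → ℕ → ℕ
  sumAt L j = sum (map g (filter (λ x → h x ≟ j) L))

  sumAt-∷ : ∀ x L j → sumAt (x ∷ L) j ≡ sumAt (x ∷ []) j + sumAt L j
  sumAt-∷ x L j with h x ≟ j
  ... | yes e rewrite filter-accept (λ y → h y ≟ j) {x} {L} e | filter-accept (λ y → h y ≟ j) {x} {[]} e =
    cong (_+ sumAt L j) (sym (+-identityʳ (g x)))
  ... | no ne rewrite filter-reject (λ y → h y ≟ j) {x} {L} ne | filter-reject (λ y → h y ≟ j) {x} {[]} ne = refl

  sumAt-single : ∀ x → sumAt (x ∷ []) (h x) ≡ g x
  sumAt-single x rewrite filter-accept (λ y → h y ≟ h x) {x} {[]} refl = +-identityʳ (g x)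

  sumAt-miss : ∀ x j → j ≢ h x → sumAt (x ∷ []) j ≡ 0
  sumAt-miss x j j≢ rewrite filter-reject (λ y → h y ≟ j) {x} {[]} (j≢ ∘ sym) = refl

  sum-sumAt : (js : List ℕ) → Unique js → (L : List X) → (∀ x → x ∈ L → h x ∈ js) →
              sum (map (sumAt L) js) ≡ sum (map g L)
  sum-sumAt js u []      _   = sum-map-0 (sumAt []) js (λ _ _ → refl)
  sum-sumAt js u (x ∷ L) h∈ = begin
    sum (map (sumAt (x ∷ L)) js)                                ≡⟨ sum-map-cong _ _ js (λ j _ → sumAt-∷ x L j) ⟩
    sum (map (λ j → sumAt (x ∷ []) j + sumAt L j) js)           ≡⟨ sum-map-+ (sumAt (x ∷ [])) (sumAt L) js ⟩
    sum (map (sumAt (x ∷ [])) js) + sum (map (sumAt L) js)      ≡⟨ cong₂ _+_ hit (sum-sumAt js u L (λ y → h∈ y ∘ there)) ⟩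
    g x + sum (map g L)                                         ∎
    where
    open ≡-Reasoning
    hit : sum (map (sumAt (x ∷ [])) js) ≡ g x
    hit = trans (sum-map-single (sumAt (x ∷ [])) js u (h∈ x (here refl)) (sumAt-miss x)) (sumAt-single x)

module _ {X : Set} {P Q : Pred X 0ℓ} (P? : Decidable P) (Q? : Decidable Q) where

  filter-≐-local : ∀ xs → (∀ x → x ∈ xs → P x → Q x) → (∀ x → x ∈ xs → Q x → P x) → filter P? xs ≡ filter Q? xs
  filter-≐-local []       _   _   = refl
  filter-≐-local (x ∷ xs) P⇒Q Q⇒P with P? x
  ... | yes px = trans (cong (x ∷_) (filter-≐-local xs (λ y → P⇒Q y ∘ there) (λ y → Q⇒P y ∘ there)))
                       (sym (filter-accept Q? (P⇒Q x (here refl) px)))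
  ... | no ¬px = trans (filter-≐-local xs (λ y → P⇒Q y ∘ there) (λ y → Q⇒P y ∘ there))
                       (sym (filter-reject Q? (¬px ∘ Q⇒P x (here refl))))

  filter-absorb : ∀ xs → (∀ x → x ∈ xs → P x → Q x) → filter P? (filter Q? xs) ≡ filter P? xs
  filter-absorb []       _   = refl
  filter-absorb (x ∷ xs) P⇒Q with Q? x
  ... | yes _  with P? x
  ...   | yes _ = cong (x ∷_) (filter-absorb xs (λ y → P⇒Q y ∘ there))
  ...   | no  _ = filter-absorb xs (λ y → P⇒Q y ∘ there)
  filter-absorb (x ∷ xs) P⇒Q | no ¬qx =
    trans (filter-absorb xs (λ y → P⇒Q y ∘ there)) (sym (filter-reject P? (¬qx ∘ P⇒Q x (here refl))))

  filter-length-< : ∀ xs → (∀ x → x ∈ xs → P x → Q x) → ∀ {v} → v ∈ xs → Q v → ¬ P v →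
                    length (filter P? xs) < length (filter Q? xs)
  filter-length-< xs P⇒Q v∈ qv ¬pv = subst (_< length (filter Q? xs)) (cong length (filter-absorb xs P⇒Q))
    (filter-notAll P? (filter Q? xs) (Any.map (λ { refl → ¬pv }) (∈-filter⁺ Q? v∈ qv)))

module FilteredSum {X : Set} (_≟ₓ_ : DecidableEquality X) where

  module _ {P : Pred X 0ℓ} (P? : Decidable P) (f : X → ℕ) where

    filteredSum : List X → ℕ
    filteredSum xs = sum (map f (filter P? (deduplicate _≟ₓ_ xs)))

    private
      filtered-unique : ∀ xs → Unique (filter P? (deduplicate _≟ₓ_ xs))
      filtered-unique xs = Unique.filter⁺ P? (DecUnique.deduplicate-! _≟ₓ_ xs)

      ∈-filtered⁻ : ∀ {xs x} → x ∈ filter P? (deduplicate _≟ₓ_ xs) → x ∈ xs × P x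
      ∈-filtered⁻ {xs} x∈ = let (x∈d , px) = ∈-filter⁻ P? x∈ in ∈-deduplicate⁻ _≟ₓ_ xs x∈d , px

      ∈-filtered⁺ : ∀ {xs x} → x ∈ xs → P x → x ∈ filter P? (deduplicate _≟ₓ_ xs)
      ∈-filtered⁺ x∈ px = ∈-filter⁺ P? (∈-deduplicate⁺ _≟ₓ_ x∈) px

    -- The sum runs over a duplicate-free list, so it only depends on the set of elements.
    filteredSum-≈ˢ : ∀ {xs ys} → xs ≈ˢ ys → filteredSum xs ≡ filteredSum ys
    filteredSum-≈ˢ {xs} {ys} xs≈ys =
      sum-↭ (↭-map⁺ f (∼bag⇒↭ (unique∧set⇒bag (filtered-unique xs) (filtered-unique ys) same)))
      where
      same : filter P? (deduplicate _≟ₓ_ xs) ≈ˢ filter P? (deduplicate _≟ₓ_ ys)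
      same = ⊆∧⊇⇒≈ˢ (λ x∈ → let (x∈xs , px) = ∈-filtered⁻ x∈ in ∈-filtered⁺ (≈ˢ⇒⊆ xs≈ys x∈xs) px)
                    (λ x∈ → let (x∈ys , px) = ∈-filtered⁻ x∈ in ∈-filtered⁺ (≈ˢ⇒⊇ xs≈ys x∈ys) px)

    filteredSum-none : ∀ xs → (∀ x → x ∈ xs → ¬ P x) → filteredSum xs ≡ 0
    filteredSum-none xs ¬P = cong (sum ∘ map f)
      (filter-none P? (All.tabulate (λ {x} x∈ → ¬P x (∈-deduplicate⁻ _≟ₓ_ xs x∈))))

    filteredSum-unique : ∀ xs x₀ → x₀ ∈ xs → P x₀ → (∀ x → x ∈ xs → P x → x ≡ x₀) → filteredSum xs ≡ f x₀
    filteredSum-unique xs x₀ x₀∈ px₀ only = trans (cong (sum ∘ map f) singleton) (+-identityʳ (f x₀))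
      where
      singleton-of : ∀ L → Unique L → (∀ x → x ∈ L → x ≡ x₀) → x₀ ∈ L → L ≡ x₀ ∷ []
      singleton-of (y ∷ [])    _              only-L _ = cong (_∷ []) (only-L y (here refl))
      singleton-of (y ∷ z ∷ L) ((y≢z ∷ _) ∷ _) only-L _ =
        contradiction (trans (only-L y (here refl)) (sym (only-L z (there (here refl))))) y≢z
      singleton : filter P? (deduplicate _≟ₓ_ xs) ≡ x₀ ∷ []
      singleton = singleton-of _ (filtered-unique xs)
        (λ x x∈ → let (x∈xs , px) = ∈-filtered⁻ x∈ in only x x∈xs px) (∈-filtered⁺ x₀∈ px₀)

    filteredSum-witness : ∀ xs → 0 < filteredSum xs → ∃[ x ] (x ∈ xs × P x)
    filteredSum-witness xs pos with filter P? (deduplicate _≟ₓ_ xs) in eq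
    ... | []    = contradiction pos (<-irrefl refl)
    ... | y ∷ _ = y , ∈-filtered⁻ (subst (y ∈_) (sym eq) (here refl))

  filteredSum-≐ : ∀ {P Q : Pred X 0ℓ} (P? : Decidable P) (Q? : Decidable Q) (f : X → ℕ) xs →
                  (∀ x → x ∈ xs → P x → Q x) → (∀ x → x ∈ xs → Q x → P x) →
                  filteredSum P? f xs ≡ filteredSum Q? f xs
  filteredSum-≐ P? Q? f xs P⇒Q Q⇒P = cong (sum ∘ map f)
    (filter-≐-local P? Q? (deduplicate _≟ₓ_ xs) (λ x → P⇒Q x ∘ ∈-deduplicate⁻ _≟ₓ_ xs) (λ x → Q⇒P x ∘ ∈-deduplicate⁻ _≟ₓ_ xs))

  filteredSum-partition : ∀ {P : Pred X 0ℓ} (P? : Decidable P) (f h : X → ℕ) xs (js : List ℕ) → Unique js →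
                          (∀ x → x ∈ xs → P x × h x ∈ js) →
                          sum (map (λ j → filteredSum (λ x → h x ≟ j) f xs) js) ≡ filteredSum P? f xs
  filteredSum-partition P? f h xs js u inside = trans
    (sum-sumAt f h js u (deduplicate _≟ₓ_ xs) (λ x x∈ → proj₂ (inside x (∈-deduplicate⁻ _≟ₓ_ xs x∈))))
    (cong (sum ∘ map f) (sym (filter-all P? (All.tabulate (λ {x} x∈ → proj₁ (inside x (∈-deduplicate⁻ _≟ₓ_ xs x∈)))))))

-- f is usually a local function that cannot be named; the inclusion argument lets Agda infer it from L.
mapMaybe-member : {X Y : Set} {f : X → Maybe Y} {xs : List X} {x : X} (L : List Y) → mapMaybe f xs ⊆ L → x ∈ xs →
                  (∃[ y ] (f x ≡ just y × y ∈ L)) ⊎ f x ≡ nothing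
mapMaybe-member {f = f} {x = x} _ ⊆L x∈ with f x in fx≡
... | just y  = inj₁ (y , refl , ⊆L (∈-mapMaybe⁺ x∈ fx≡))
... | nothing = inj₂ refl

qty-pos : ∀ o → 0 < qty o
qty-pos (mkOrder _ _ q _ q>0) = recompute (0 <? q) q>0

order-ext : ∀ {o o'} → key o ≡ key o' → qty o ≡ qty o' → o ≡ o'
order-ext {mkOrder _ _ _ _ _} {mkOrder _ _ _ _ _} refl refl = refl

tqty-pos : ∀ t → 0 < tqty t
tqty-pos (mkTrans _ _ q q>0) = recompute (0 <? q) q>0

transaction-ext : ∀ {t t'} → idBid t ≡ idBid t' → idAsk t ≡ idAsk t' → tqty t ≡ tqty t' → t ≡ t'
transaction-ext {mkTrans _ _ _ _} {mkTrans _ _ _ _} refl refl refl = refl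

-- Quantities, traded parts and multiset difference

module TSum = FilteredSum _≟ᵗ_
module OSum = FilteredSum _≟ᵒ_

-- QtyBid M and QtyAsk M are qtyBy idBid M and qtyBy idAsk M by definition.
qtyBy : (Transaction → ℕ) → TransSet → ℕ → ℕ
qtyBy side M i = TSum.filteredSum (λ t → side t ≟ i) tqty M

qtyBy-zero : ∀ side M i → (∀ t → t ∈ M → side t ≢ i) → qtyBy side M i ≡ 0
qtyBy-zero side M i = TSum.filteredSum-none (λ t → side t ≟ i) tqty M

qtyBy-witness : ∀ side M i → 0 < qtyBy side M i → ∃[ t ] (t ∈ M × side t ≡ i)
qtyBy-witness side M i = TSum.filteredSum-witness (λ t → side t ≟ i) tqty M

pairQty-witness : ∀ M i j → 0 < PairQty M i j → ∃[ t ] (t ∈ M × idBid t ≡ i × idAsk t ≡ j)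
pairQty-witness M i j = TSum.filteredSum-witness (λ t → (idBid t ≟ i) ×-dec (idAsk t ≟ j)) tqty M

module _ {M : TransSet} where

  module _ {i₀} (fixed : ∀ {t} → t ∈ M → idBid t ≡ i₀) where

    pairQty-fixed-bid : ∀ j → PairQty M i₀ j ≡ QtyAsk M j
    pairQty-fixed-bid j = TSum.filteredSum-≐ (λ t → (idBid t ≟ i₀) ×-dec (idAsk t ≟ j)) (λ t → idAsk t ≟ j) tqty M
      (λ _ _ → proj₂) (λ t t∈ a≡ → fixed t∈ , a≡)

    pairQty-other-bid : ∀ {i} j → i ≢ i₀ → PairQty M i j ≡ 0
    pairQty-other-bid j i≢ = TSum.filteredSum-none (λ t → (idBid t ≟ _) ×-dec (idAsk t ≟ j)) tqty M
      (λ t t∈ (b≡ , _) → i≢ (trans (sym b≡) (fixed t∈)))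

  module _ {j₀} (fixed : ∀ {t} → t ∈ M → idAsk t ≡ j₀) where

    pairQty-fixed-ask : ∀ i → PairQty M i j₀ ≡ QtyBid M i
    pairQty-fixed-ask i = TSum.filteredSum-≐ (λ t → (idBid t ≟ i) ×-dec (idAsk t ≟ j₀)) (λ t → idBid t ≟ i) tqty M
      (λ _ _ → proj₁) (λ t t∈ b≡ → b≡ , fixed t∈)

    pairQty-other-ask : ∀ i {j} → j ≢ j₀ → PairQty M i j ≡ 0
    pairQty-other-ask i j≢ = TSum.filteredSum-none (λ t → (idBid t ≟ i) ×-dec (idAsk t ≟ _)) tqty M
      (λ t t∈ (_ , a≡) → j≢ (trans (sym a≡) (fixed t∈)))

mult-≈ˢ : ∀ {X Y} → X ≈ˢ Y → ∀ k → mult X k ≡ mult Y k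
mult-≈ˢ X≈Y k = OSum.filteredSum-≈ˢ (λ o → key o ≟ᵏ k) qty X≈Y

record TradedPart (q : ℕ → ℕ) (X R : OrderSet) : Set where
  field
    traded⁻ : ∀ {x} → x ∈ R → ∃[ b ] (b ∈ X × 0 < q (id b) × key x ≡ key b × qty x ≡ q (id b))
    traded⁺ : ∀ {b} → b ∈ X → 0 < q (id b) → ∃[ x ] (x ∈ R × key x ≡ key b × qty x ≡ q (id b))

Bids-tradedPart : ∀ M X → TradedPart (QtyBid M) X (Bids M X)
Bids-tradedPart M X = record { traded⁻ = traded⁻ ; traded⁺ = traded⁺ }
  where
  traded⁻ : ∀ {x} → x ∈ Bids M X → ∃[ b ] (b ∈ X × 0 < QtyBid M (id b) × key x ≡ key b × qty x ≡ QtyBid M (id b))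
  traded⁻ x∈ with ∈-mapMaybe⁻ X x∈
  ... | b , b∈ , e with 0 <? QtyBid M (id b)
  ...   | yes pos with refl ← e = b , b∈ , pos , refl , refl
  ...   | no  _   with () ← e
  traded⁺ : ∀ {b} → b ∈ X → 0 < QtyBid M (id b) → ∃[ x ] (x ∈ Bids M X × key x ≡ key b × qty x ≡ QtyBid M (id b))
  traded⁺ {b} b∈ pos with mapMaybe-member (Bids M X) (λ p → p) b∈
  ... | inj₁ (x , e , x∈) with 0 <? QtyBid M (id b)
  ...   | yes _   with refl ← e = x , x∈ , refl , refl
  ...   | no ¬pos = contradiction pos ¬pos
  traded⁺ {b} b∈ pos | inj₂ e with 0 <? QtyBid M (id b)
  ...   | yes _   with () ← e
  ...   | no ¬pos = contradiction pos ¬pos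

Asks-tradedPart : ∀ M X → TradedPart (QtyAsk M) X (Asks M X)
Asks-tradedPart M X = record { traded⁻ = traded⁻ ; traded⁺ = traded⁺ }
  where
  traded⁻ : ∀ {x} → x ∈ Asks M X → ∃[ a ] (a ∈ X × 0 < QtyAsk M (id a) × key x ≡ key a × qty x ≡ QtyAsk M (id a))
  traded⁻ x∈ with ∈-mapMaybe⁻ X x∈
  ... | a , a∈ , e with 0 <? QtyAsk M (id a)
  ...   | yes pos with refl ← e = a , a∈ , pos , refl , refl
  ...   | no  _   with () ← e
  traded⁺ : ∀ {a} → a ∈ X → 0 < QtyAsk M (id a) → ∃[ x ] (x ∈ Asks M X × key x ≡ key a × qty x ≡ QtyAsk M (id a))
  traded⁺ {a} a∈ pos with mapMaybe-member (Asks M X) (λ p → p) a∈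
  ... | inj₁ (x , e , x∈) with 0 <? QtyAsk M (id a)
  ...   | yes _   with refl ← e = x , x∈ , refl , refl
  ...   | no ¬pos = contradiction pos ¬pos
  traded⁺ {a} a∈ pos | inj₂ e with 0 <? QtyAsk M (id a)
  ...   | yes _   with () ← e
  ...   | no ¬pos = contradiction pos ¬pos

tradedPart-≈ˢ : ∀ {q q' X X' R R'} → TradedPart q X R → TradedPart q' X' R' → X ≈ˢ X' → (∀ i → q i ≡ q' i) → R ≈ˢ R'
tradedPart-≈ˢ T T' X≈X' q≡q' = ⊆∧⊇⇒≈ˢ (into T T' (≈ˢ⇒⊆ X≈X') q≡q') (into T' T (≈ˢ⇒⊇ X≈X') (sym ∘ q≡q'))
  where
  into : ∀ {q₁ q₂ X₁ X₂ R₁ R₂} → TradedPart q₁ X₁ R₁ → TradedPart q₂ X₂ R₂ → X₁ ⊆ X₂ → (∀ i → q₁ i ≡ q₂ i) → R₁ ⊆ R₂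
  into T₁ T₂ X₁⊆X₂ q₁≡q₂ x∈ with TradedPart.traded⁻ T₁ x∈
  ... | b , b∈ , pos , kx , qx with TradedPart.traded⁺ T₂ (X₁⊆X₂ b∈) (subst (0 <_) (q₁≡q₂ _) pos)
  ...   | x' , x'∈ , kx' , qx' = subst (_∈ _) (order-ext (trans kx' (sym kx)) (trans qx' (trans (sym (q₁≡q₂ _)) (sym qx)))) x'∈

canonical-cong : ∀ M₁ M₂ → (∀ i j → PairQty M₁ i j ≡ PairQty M₂ i j) → canonical M₁ ≈ˢ canonical M₂
canonical-cong M₁ M₂ pq≡ = ⊆∧⊇⇒≈ˢ (into M₁ M₂ pq≡) (into M₂ M₁ (λ i j → sym (pq≡ i j)))
  where
  ∈-canonical⁻ : ∀ M {x} → x ∈ canonical M → tqty x ≡ PairQty M (idBid x) (idAsk x)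
  ∈-canonical⁻ M x∈ with ∈-mapMaybe⁻ M (∈-deduplicate⁻ _≟ᵗ_ _ x∈)
  ... | t , _ , e with 0 <? PairQty M (idBid t) (idAsk t)
  ...   | yes _ with refl ← e = refl
  ...   | no  _ with () ← e
  ∈-canonical⁺ : ∀ M {t} → t ∈ M → 0 < PairQty M (idBid t) (idAsk t) →
                 ∃[ x ] (x ∈ canonical M × idBid x ≡ idBid t × idAsk x ≡ idAsk t)
  ∈-canonical⁺ M {t} t∈ pos with mapMaybe-member (canonical M) (∈-deduplicate⁺ _≟ᵗ_) t∈
  ... | inj₁ (x , e , x∈) with 0 <? PairQty M (idBid t) (idAsk t)
  ...   | yes _ with refl ← e = x , x∈ , refl , refl
  ...   | no ¬pos = contradiction pos ¬pos
  ∈-canonical⁺ M {t} t∈ pos | inj₂ e with 0 <? PairQty M (idBid t) (idAsk t)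
  ...   | yes _ with () ← e
  ...   | no ¬pos = contradiction pos ¬pos
  into : ∀ M₁ M₂ → (∀ i j → PairQty M₁ i j ≡ PairQty M₂ i j) → canonical M₁ ⊆ canonical M₂
  into M₁ M₂ pq≡ {x} x∈ = from-witness (pairQty-witness M₂ (idBid x) (idAsk x) pos)
    where
    qx≡ : tqty x ≡ PairQty M₂ (idBid x) (idAsk x)
    qx≡ = trans (∈-canonical⁻ M₁ x∈) (pq≡ _ _)
    pos : 0 < PairQty M₂ (idBid x) (idAsk x)
    pos = subst (0 <_) qx≡ (tqty-pos x)
    from-witness : ∃[ t ] (t ∈ M₂ × idBid t ≡ idBid x × idAsk t ≡ idAsk x) → x ∈ canonical M₂
    from-witness (t , t∈ , refl , refl) with ∈-canonical⁺ M₂ t∈ pos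
    ... | x' , x'∈ , b≡ , a≡ =
      subst (_∈ canonical M₂) (transaction-ext b≡ a≡ (trans (∈-canonical⁻ M₂ x'∈) (trans (cong₂ (PairQty M₂) b≡ a≡) (sym qx≡)))) x'∈

IdUnique : OrderSet → Set
IdUnique X = ∀ {o o'} → o ∈ X → o' ∈ X → id o ≡ id o' → o ≡ o'

TimestampUnique : OrderSet → Set
TimestampUnique X = ∀ {o o'} → o ∈ X → o' ∈ X → o ≢ o' → timestamp o ≢ timestamp o'

mult-member : ∀ {X p} → IdUnique X → p ∈ X → mult X (key p) ≡ qty p
mult-member {X} {p} unique p∈ =
  OSum.filteredSum-unique (λ o → key o ≟ᵏ key p) qty X p p∈ refl (λ o o∈ k≡ → unique o∈ p∈ (cong proj₁ k≡))

module _ {q : ℕ → ℕ} {X R : OrderSet} (unique : IdUnique X) (T : TradedPart q X R) where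
  open TradedPart T

  private
    traded-from : ∀ {x b} → x ∈ R → b ∈ X → key x ≡ key b → 0 < q (id b) × qty x ≡ q (id b)
    traded-from x∈ b∈ kx≡ with traded⁻ x∈
    ... | b' , b'∈ , pos , kx , qx with unique b'∈ b∈ (cong proj₁ (trans (sym kx) kx≡))
    ...   | refl = pos , qx

  mult-tradedPart : ∀ {b} → b ∈ X → mult R (key b) ≡ q (id b)
  mult-tradedPart {b} b∈ with q (id b) in qb≡
  ... | zero = OSum.filteredSum-none (λ o → key o ≟ᵏ key b) qty R
                 (λ x x∈ kx≡ → contradiction (subst (0 <_) qb≡ (proj₁ (traded-from x∈ b∈ kx≡))) (<-irrefl refl))
  ... | suc n with traded⁺ b∈ (subst (0 <_) (sym qb≡) z<s)
  ...   | x₀ , x₀∈ , kx₀ , qx₀ =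
    trans (OSum.filteredSum-unique (λ o → key o ≟ᵏ key b) qty R x₀ x₀∈ kx₀
             (λ x x∈ kx≡ → order-ext (trans kx≡ (sym kx₀)) (trans (proj₂ (traded-from x∈ b∈ kx≡)) (sym qx₀))))
          (trans qx₀ qb≡)

module _ (X Y : OrderSet) where

  ∈-−ᵐ⁻ : ∀ {o} → o ∈ X −ᵐ Y → ∃[ p ] (p ∈ X × key p ≡ key o × qty o ≡ mult X (key o) ∸ mult Y (key o))
  ∈-−ᵐ⁻ o∈ with ∈-mapMaybe⁻ (deduplicate _≟ᵏ_ (map key X)) o∈
  ... | (i , t , pr) , k∈ , e with 0 <? (mult X (i , t , pr) ∸ mult Y (i , t , pr))
  ...   | no  _ with () ← e
  ...   | yes _ with refl ← e with ∈-map⁻ key (∈-deduplicate⁻ _≟ᵏ_ (map key X) k∈)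
  ...     | p , p∈ , k≡ = p , p∈ , sym k≡ , refl

  ∈-−ᵐ⁺ : ∀ {p} → p ∈ X → 0 < mult X (key p) ∸ mult Y (key p) →
          ∃[ o ] (o ∈ X −ᵐ Y × key o ≡ key p × qty o ≡ mult X (key p) ∸ mult Y (key p))
  ∈-−ᵐ⁺ {p} p∈ pos with mapMaybe-member (X −ᵐ Y) (λ o∈ → o∈) (∈-deduplicate⁺ _≟ᵏ_ (∈-map⁺ key p∈))
  ... | inj₁ (o , e , o∈) with 0 <? (mult X (key p) ∸ mult Y (key p))
  ...   | yes _ with refl ← e = o , o∈ , refl , refl
  ...   | no ¬pos = contradiction pos ¬pos
  ∈-−ᵐ⁺ {p} p∈ pos | inj₂ e with 0 <? (mult X (key p) ∸ mult Y (key p))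
  ...   | yes _ with () ← e
  ...   | no ¬pos = contradiction pos ¬pos

  −ᵐ-key-injective : ∀ {o o'} → o ∈ X −ᵐ Y → o' ∈ X −ᵐ Y → key o ≡ key o' → o ≡ o'
  −ᵐ-key-injective o∈ o'∈ k≡ =
    order-ext k≡ (trans (qty-of o∈) (trans (cong (λ k → mult X k ∸ mult Y k) k≡) (sym (qty-of o'∈))))
    where
    qty-of : ∀ {o} → o ∈ X −ᵐ Y → qty o ≡ mult X (key o) ∸ mult Y (key o)
    qty-of o∈ = let (_ , _ , _ , q≡) = ∈-−ᵐ⁻ o∈ in q≡

−ᵐ-cong : ∀ {X₁ Y₁ X₂ Y₂} → X₁ ≈ˢ X₂ → (∀ k → mult Y₁ k ≡ mult Y₂ k) → (X₁ −ᵐ Y₁) ≈ˢ (X₂ −ᵐ Y₂)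
−ᵐ-cong X₁≈X₂ Y₁≡Y₂ = ⊆∧⊇⇒≈ˢ (into X₁≈X₂ Y₁≡Y₂) (into (≈ˢ.sym X₁≈X₂) (sym ∘ Y₁≡Y₂))
  where
  into : ∀ {X₁ Y₁ X₂ Y₂} → X₁ ≈ˢ X₂ → (∀ k → mult Y₁ k ≡ mult Y₂ k) → (X₁ −ᵐ Y₁) ⊆ (X₂ −ᵐ Y₂)
  into {X₁} {Y₁} {X₂} {Y₂} X₁≈X₂ Y₁≡Y₂ {o} o∈ with ∈-−ᵐ⁻ X₁ Y₁ o∈
  ... | p , p∈ , refl , qo with trans qo (cong₂ _∸_ (mult-≈ˢ X₁≈X₂ (key p)) (Y₁≡Y₂ (key p)))
  ...   | qo' with ∈-−ᵐ⁺ X₂ Y₂ (≈ˢ⇒⊆ X₁≈X₂ p∈) (subst (0 <_) qo' (qty-pos o))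
  ...     | o' , o'∈ , ko' , qo'' = subst (_∈ X₂ −ᵐ Y₂) (order-ext ko' (trans qo'' (sym qo'))) o'∈

residual : ∀ {q X R b} → IdUnique X → TradedPart q X R → b ∈ X → q (id b) < qty b → ∃[ r ] (r ∈ X −ᵐ R × key r ≡ key b)
residual {q} {X} {R} {b} unique T b∈ q<qty with ∈-−ᵐ⁺ X R b∈ pos
  where
  pos : 0 < mult X (key b) ∸ mult R (key b)
  pos rewrite mult-member unique b∈ | mult-tradedPart unique T b∈ = m<n⇒0<n∸m q<qty
... | r , r∈ , kr , _ = r , r∈ , kr

-- Price-time priority and greedy fills

record Priority : Set₁ where
  field
    _≻_      : Order → Order → Set
    _≻?_     : ∀ o o' → Dec (o ≻ o')
    ≻-trans  : ∀ {o o' o''} → o ≻ o' → o' ≻ o'' → o ≻ o''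
    ≻-irrefl : ∀ {o} → ¬ o ≻ o
    ≻-total  : ∀ o o' → timestamp o ≢ timestamp o' → o ≻ o' ⊎ o' ≻ o

priceTimePriority : {_⊏_ : ℕ → ℕ → Set} → Transitive _⊏_ → Trichotomous _≡_ _⊏_ → Priority
priceTimePriority {_⊏_} ⊏-trans ⊏-cmp = record
  { _≻_      = _≻_
  ; _≻?_     = λ o o' → (tri⇒dec< ⊏-cmp (price o) (price o')) ⊎-dec ((price o ≟ price o') ×-dec (timestamp o <? timestamp o'))
  ; ≻-trans  = λ {o} {o'} {o''} → ≻-trans {o} {o'} {o''}
  ; ≻-irrefl = λ {o} → ≻-irrefl {o}
  ; ≻-total  = ≻-total
  }
  where
  _≻_ : Order → Order → Set
  o ≻ o' = price o ⊏ price o' ⊎ (price o ≡ price o' × timestamp o < timestamp o')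

  ≻-trans : ∀ {o o' o''} → o ≻ o' → o' ≻ o'' → o ≻ o''
  ≻-trans (inj₁ p⊏p')         (inj₁ p'⊏p'')         = inj₁ (⊏-trans p⊏p' p'⊏p'')
  ≻-trans (inj₁ p⊏p')         (inj₂ (refl , _))     = inj₁ p⊏p'
  ≻-trans (inj₂ (refl , _))   (inj₁ p'⊏p'')         = inj₁ p'⊏p''
  ≻-trans (inj₂ (refl , t<t')) (inj₂ (refl , t'<t'')) = inj₂ (refl , <-trans t<t' t'<t'')

  ≻-irrefl : ∀ {o} → ¬ o ≻ o
  ≻-irrefl (inj₁ p⊏p)      = tri⇒irr ⊏-cmp refl p⊏p
  ≻-irrefl (inj₂ (_ , t<t)) = <-irrefl refl t<t

  ≻-total : ∀ o o' → timestamp o ≢ timestamp o' → o ≻ o' ⊎ o' ≻ o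
  ≻-total o o' t≢t' with ⊏-cmp (price o) (price o') | <-cmp (timestamp o) (timestamp o')
  ... | tri< p⊏p' _ _ | _              = inj₁ (inj₁ p⊏p')
  ... | tri> _ _ p'⊏p | _              = inj₂ (inj₁ p'⊏p)
  ... | tri≈ _ p≡p' _ | tri< t<t' _ _ = inj₁ (inj₂ (p≡p' , t<t'))
  ... | tri≈ _ p≡p' _ | tri≈ _ t≡t' _ = contradiction t≡t' t≢t'
  ... | tri≈ _ p≡p' _ | tri> _ _ t'<t = inj₂ (inj₂ (sym p≡p' , t'<t))

>-cmp : Trichotomous _≡_ _>_
>-cmp m n with <-cmp n m
... | tri< n<m n≢m ¬m<n = tri< n<m (n≢m ∘ sym) ¬m<n
... | tri≈ ¬n<m n≡m ¬m<n = tri≈ ¬n<m (sym n≡m) ¬m<n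
... | tri> ¬n<m n≢m m<n = tri> ¬n<m (n≢m ∘ sym) m<n

-- Priority._≻_ askPriority and Priority._≻_ bidPriority are _≻ask_ and _≻bid_ by definition.
askPriority : Priority
askPriority = priceTimePriority <-trans <-cmp

bidPriority : Priority
bidPriority = priceTimePriority (λ m>n n>k → <-trans n>k m>n) >-cmp

module Greedy (π : Priority) (R : OrderSet) (ts-unique : TimestampUnique R) (Tr : Order → Set) (C : ℕ) where
  open Priority π

  idsR : List ℕ
  idsR = deduplicate _≟_ (ids R)

  id∈idsR : ∀ {a} → a ∈ R → id a ∈ idsR
  id∈idsR a∈ = ∈-deduplicate⁺ _≟_ (∈-map⁺ id a∈)

  ∈idsR⇒id : ∀ {j} → j ∈ idsR → ∃[ b ] (b ∈ R × id b ≡ j)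
  ∈idsR⇒id {j} j∈ = let (b , b∈ , j≡) = ∈-map⁻ id (∈-deduplicate⁻ _≟_ (ids R) j∈) in b , b∈ , sym j≡

  comparable : ∀ {a b} → a ∈ R → b ∈ R → a ≡ b ⊎ a ≻ b ⊎ b ≻ a
  comparable {a} {b} a∈ b∈ with a ≟ᵒ b
  ... | yes a≡b = inj₁ a≡b
  ... | no  a≢b = inj₂ (≻-total a b (ts-unique a∈ b∈ a≢b))

  rank : Order → ℕ
  rank a = length (filter (_≻? a) R)

  rank-< : ∀ {a b} → b ∈ R → b ≻ a → rank b < rank a
  rank-< {a} {b} b∈ b≻a = filter-length-< (_≻? b) (_≻? a) R (λ _ _ c≻b → ≻-trans c≻b b≻a) b∈ b≻a ≻-irrefl

  ≻-induction : (P : Order → Set) → (∀ {a} → a ∈ R → (∀ {b} → b ∈ R → b ≻ a → P b) → P a) → ∀ {a} → a ∈ R → P a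
  ≻-induction P step {a} = WF.All.wfRec wf 0ℓ (λ a → a ∈ R → P a) (λ a rec a∈ → step a∈ (λ b∈ b≻a → rec (b∈ , b≻a) b∈)) a
    where
    _⊐_ : Order → Order → Set
    b ⊐ a = b ∈ R × b ≻ a
    wf : WF.WellFounded _⊐_
    wf = WF.Subrelation.wellFounded (λ (b∈ , b≻a) → rank-< b∈ b≻a) (On.wellFounded rank <-wellFounded)

  record Fill (q : ℕ → ℕ) : Set where
    field
      bounded   : sum (map q idsR) ≤ C
      capped    : ∀ {a} → a ∈ R → q (id a) ≤ qty a
      prior     : ∀ {a b} → a ∈ R → b ∈ R → a ≻ b → 0 < q (id b) → q (id a) ≡ qty a
      tradable  : ∀ {a} → a ∈ R → 0 < q (id a) → Tr a
      exhausted : ∀ {a} → a ∈ R → Tr a → q (id a) < qty a → sum (map q idsR) ≡ C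

  no-shortfall : ∀ {q₁ q₂} → Fill q₁ → Fill q₂ → ∀ {a} → a ∈ R →
                 (∀ {b} → b ∈ R → b ≻ a → q₁ (id b) ≡ q₂ (id b)) → ¬ q₁ (id a) < q₂ (id a)
  no-shortfall {q₁} {q₂} F₁ F₂ {a} a∈ better-agree q₁<q₂ = <-irrefl refl (begin-strict
    sum (map q₁ idsR) <⟨ sum-map-< q₁ q₂ idsR pointwise (id∈idsR a∈) q₁<q₂ ⟩
    sum (map q₂ idsR) ≤⟨ Fill.bounded F₂ ⟩
    C                 ≡⟨ exhausted₁ ⟨
    sum (map q₁ idsR) ∎)
    where
    open ≤-Reasoning
    unfilled : q₁ (id a) < qty a
    unfilled = <-≤-trans q₁<q₂ (Fill.capped F₂ a∈)
    exhausted₁ : sum (map q₁ idsR) ≡ C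
    exhausted₁ = Fill.exhausted F₁ a∈ (Fill.tradable F₂ a∈ (≤-<-trans z≤n q₁<q₂)) unfilled
    pointwise : ∀ j → j ∈ idsR → q₁ j ≤ q₂ j
    pointwise j j∈ with ∈idsR⇒id j∈
    ... | b , b∈ , refl with comparable a∈ b∈
    ...   | inj₁ refl        = <⇒≤ q₁<q₂
    ...   | inj₂ (inj₂ b≻a) = ≤-reflexive (better-agree b∈ b≻a)
    ...   | inj₂ (inj₁ a≻b) with q₁ (id b) in q₁b≡
    ...     | zero  = z≤n
    ...     | suc _ = contradiction (Fill.prior F₁ a∈ b∈ a≻b (subst (0 <_) (sym q₁b≡) z<s)) (<⇒≢ unfilled)

  fill-unique : ∀ {q₁ q₂} → Fill q₁ → Fill q₂ → ∀ {a} → a ∈ R → q₁ (id a) ≡ q₂ (id a)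
  fill-unique {q₁} {q₂} F₁ F₂ = ≻-induction (λ a → q₁ (id a) ≡ q₂ (id a)) step
    where
    step : ∀ {a} → a ∈ R → (∀ {b} → b ∈ R → b ≻ a → q₁ (id b) ≡ q₂ (id b)) → q₁ (id a) ≡ q₂ (id a)
    step {a} a∈ ih with <-cmp (q₁ (id a)) (q₂ (id a))
    ... | tri< q₁<q₂ _ _ = contradiction q₁<q₂ (no-shortfall F₁ F₂ a∈ ih)
    ... | tri≈ _ q₁≡q₂ _ = q₁≡q₂
    ... | tri> _ _ q₂<q₁ = contradiction q₂<q₁ (no-shortfall F₂ F₁ a∈ (λ b∈ b≻a → sym (ih b∈ b≻a)))

-- Sweeps of one side of the book

-- The incoming order ω takes the role given by the projection taker; the resting orders R
-- take the role given by maker, and Tr r says that r is tradable with ω.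
record Sweep (π : Priority) (taker maker : Transaction → ℕ) (Tr : Order → Set)
             (ω : Order) (R : OrderSet) (M : TransSet) : Set where
  field
    shape        : ∀ {t} → t ∈ M → taker t ≡ id ω × ∃[ r ] (r ∈ R × maker t ≡ id r × Tr r)
    taker-capped : qtyBy taker M (id ω) ≤ qty ω
    maker-capped : ∀ {r} → r ∈ R → qtyBy maker M (id r) ≤ qty r
    prior        : ∀ {r r'} → r ∈ R → r' ∈ R → Priority._≻_ π r r' → id r' ∈ map maker M →
                   qtyBy maker M (id r) ≡ qty r
    exhausted    : ∀ {r} → r ∈ R → Tr r → qtyBy maker M (id r) < qty r → qtyBy taker M (id ω) ≡ qty ω

module _ {π : Priority} {taker maker : Transaction → ℕ} {Tr : Order → Set} {ω : Order} {R R' : OrderSet} {M : TransSet} where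

  sweep-≈ˢ : R ≈ˢ R' → Sweep π taker maker Tr ω R M → Sweep π taker maker Tr ω R' M
  sweep-≈ˢ R≈R' S = record
    { shape        = λ t∈ → let (taker≡ , r , r∈ , maker≡ , tr) = shape t∈ in taker≡ , r , ≈ˢ⇒⊆ R≈R' r∈ , maker≡ , tr
    ; taker-capped = taker-capped
    ; maker-capped = maker-capped ∘ ≈ˢ⇒⊇ R≈R'
    ; prior        = λ r∈ r'∈ → prior (≈ˢ⇒⊇ R≈R' r∈) (≈ˢ⇒⊇ R≈R' r'∈)
    ; exhausted    = exhausted ∘ ≈ˢ⇒⊇ R≈R'
    }
    where open Sweep S

module SweepFill {π taker maker Tr ω R M} (S : Sweep π taker maker Tr ω R M)
                 (id-unique : IdUnique R) (ts-unique : TimestampUnique R) where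
  open Sweep S
  open Greedy π R ts-unique Tr (qty ω)

  maker-tradable : ∀ {r} → r ∈ R → 0 < qtyBy maker M (id r) → Tr r
  maker-tradable r∈ pos with qtyBy-witness maker M _ pos
  ... | t , t∈ , maker≡ with shape t∈
  ...   | _ , r' , r'∈ , maker≡' , tr with id-unique r'∈ r∈ (trans (sym maker≡') maker≡)
  ...     | refl = tr

  maker-zero : ∀ j → j ∉ idsR → qtyBy maker M j ≡ 0
  maker-zero j j∉ = qtyBy-zero maker M j (λ t t∈ maker≡ →
    let (_ , r , r∈ , maker≡' , _) = shape t∈ in j∉ (subst (_∈ idsR) (trans (sym maker≡') maker≡) (id∈idsR r∈)))

  taker-zero : ∀ i → i ≢ id ω → qtyBy taker M i ≡ 0
  taker-zero i i≢ = qtyBy-zero taker M i (λ t t∈ taker≡ → i≢ (trans (sym taker≡) (proj₁ (shape t∈))))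

  total : sum (map (qtyBy maker M) idsR) ≡ qtyBy taker M (id ω)
  total = TSum.filteredSum-partition (λ t → taker t ≟ id ω) tqty maker M idsR (DecUnique.deduplicate-! _≟_ (ids R))
    (λ t t∈ → let (taker≡ , r , r∈ , maker≡ , _) = shape t∈ in taker≡ , subst (_∈ idsR) (sym maker≡) (id∈idsR r∈))

  fill : Fill (qtyBy maker M)
  fill = record
    { bounded   = subst (_≤ qty ω) (sym total) taker-capped
    ; capped    = maker-capped
    ; prior     = λ r∈ r'∈ r≻r' pos → let (t , t∈ , maker≡) = qtyBy-witness maker M _ pos in
                    prior r∈ r'∈ r≻r' (subst (_∈ map maker M) maker≡ (∈-map⁺ maker t∈))
    ; tradable  = maker-tradable
    ; exhausted = λ r∈ tr unfilled → trans total (exhausted r∈ tr unfilled)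
    }

sweep-agree : ∀ {π taker maker Tr ω R M₁ M₂} → IdUnique R → TimestampUnique R →
              Sweep π taker maker Tr ω R M₁ → Sweep π taker maker Tr ω R M₂ →
              (∀ j → qtyBy maker M₁ j ≡ qtyBy maker M₂ j) × (∀ i → qtyBy taker M₁ i ≡ qtyBy taker M₂ i)
sweep-agree {π} {taker} {maker} {Tr} {ω} {R} {M₁} {M₂} id-unique ts-unique S₁ S₂ = maker≡ , taker≡
  where
  module F₁ = SweepFill S₁ id-unique ts-unique
  module F₂ = SweepFill S₂ id-unique ts-unique
  open Greedy π R ts-unique Tr (qty ω)

  maker≡ : ∀ j → qtyBy maker M₁ j ≡ qtyBy maker M₂ j
  maker≡ j with j ∈? idsR
  ... | yes j∈ with ∈idsR⇒id j∈
  ...   | r , r∈ , refl = fill-unique F₁.fill F₂.fill r∈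
  maker≡ j | no j∉ = trans (F₁.maker-zero j j∉) (sym (F₂.maker-zero j j∉))

  taker≡ : ∀ i → qtyBy taker M₁ i ≡ qtyBy taker M₂ i
  taker≡ i with i ≟ id ω
  ... | yes refl = trans (sym F₁.total) (trans (sum-map-cong _ _ idsR (λ j _ → maker≡ j)) F₂.total)
  ... | no i≢    = trans (F₁.taker-zero i i≢) (sym (F₂.taker-zero i i≢))

-- One step of a valid process

record ValidProcess (P : Process) : Set where
  field
    spread       : PositiveBidAskSpread P
    priority     : PriceTimePriority P
    conservation : Conservation P

trades : Process → OrderSet → OrderSet → Instruction → TransSet
trades P B A τ = proj₂ (proj₂ (P B A τ))

-- Admissible B A is AdmissibleList (B ++ A) by definition.
AdmissibleList : OrderSet → Set
AdmissibleList L = ∀ o o' → o ∈ L → o' ∈ L → o ≢ o' → (id o ≢ id o') × (timestamp o ≢ timestamp o')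

module _ {L : OrderSet} (adm : AdmissibleList L) where

  admissible-⊆ : ∀ {L'} → L' ⊆ L → AdmissibleList L'
  admissible-⊆ L'⊆L o o' o∈ o'∈ = adm o o' (L'⊆L o∈) (L'⊆L o'∈)

  admissible⇒id-unique : IdUnique L
  admissible⇒id-unique {o} {o'} o∈ o'∈ id≡ with o ≟ᵒ o'
  ... | yes o≡o' = o≡o'
  ... | no  o≢o' = contradiction id≡ (proj₁ (adm o o' o∈ o'∈ o≢o'))

  admissible⇒ts-unique : TimestampUnique L
  admissible⇒ts-unique o∈ o'∈ o≢o' = proj₂ (adm _ _ o∈ o'∈ o≢o')

module _ {B A : OrderSet} (adm : Admissible B A) where

  admissible-bids : AdmissibleList B
  admissible-bids = admissible-⊆ adm ∈-++⁺ˡ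

  admissible-asks : AdmissibleList A
  admissible-asks = admissible-⊆ adm (∈-++⁺ʳ B)

module _ {P : Process} (V : ValidProcess P) {B A : OrderSet} {τ : Instruction} (legal : LegalInput B A τ) where
  open ValidProcess V
  private
    B' = proj₁ (Absorb B A τ)
    A' = proj₂ (Absorb B A τ)
    M  = trades P B A τ

  matching : Matching M B' A'
  matching = proj₁ (conservation B A τ legal)

  -- Partially filled tradable orders would leave a matchable book behind.
  partial-fills-untradable : ∀ {b a} → b ∈ B' → a ∈ A' → Tradable b a →
                             QtyBid M (id b) < qty b → QtyAsk M (id a) < qty a → ⊥
  partial-fills-untradable b∈ a∈ b~a b-unfilled a-unfilled
    with residual (admissible⇒id-unique (admissible-bids (proj₂ legal))) (Bids-tradedPart M B') b∈ b-unfilled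
       | residual (admissible⇒id-unique (admissible-asks (proj₂ legal))) (Asks-tradedPart M A') a∈ a-unfilled
  ... | rb , rb∈ , refl | ra , ra∈ , refl =
    spread B A τ legal (rb , ra , ≈ˢ⇒⊇ (proj₁ (proj₂ (conservation B A τ legal))) rb∈
                              , ≈ˢ⇒⊇ (proj₂ (proj₂ (conservation B A τ legal))) ra∈ , b~a)

module _ {P : Process} (V : ValidProcess P) where
  open ValidProcess V

  buy-sweep : ∀ {B A β} (legal : LegalInput B A (Buy , β)) →
              Sweep askPriority idBid idAsk (Tradable β) β A (trades P B A (Buy , β))
  buy-sweep {B} {A} {β} legal = record
    { shape        = shape
    ; taker-capped = proj₁ (proj₂ (matching V legal)) β (here refl)
    ; maker-capped = proj₂ (proj₂ (matching V legal)) _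
    ; prior        = proj₁ (priority B A (Buy , β) legal) _ _
    ; exhausted    = exhausted
    }
    where
    M = trades P B A (Buy , β)
    shape : ∀ {t} → t ∈ M → idBid t ≡ id β × ∃[ a ] (a ∈ A × idAsk t ≡ id a × Tradable β a)
    shape t∈ with proj₁ (matching V legal) _ t∈
    ... | b , a , here refl , a∈ , b≡ , a≡ , b~a , _ = b≡ , a , a∈ , a≡ , b~a
    ... | b , a , there b∈  , a∈ , _  , _  , b~a , _ = contradiction (b , a , b∈ , a∈ , b~a) (proj₁ legal)
    exhausted : ∀ {a} → a ∈ A → Tradable β a → QtyAsk M (id a) < qty a → QtyBid M (id β) ≡ qty β
    exhausted a∈ β~a a-unfilled with m≤n⇒m<n∨m≡n (proj₁ (proj₂ (matching V legal)) β (here refl))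
    ... | inj₁ β-unfilled = ⊥-elim (partial-fills-untradable V legal (here refl) a∈ β~a β-unfilled a-unfilled)
    ... | inj₂ β-filled   = β-filled

  sell-sweep : ∀ {B A α} (legal : LegalInput B A (Sell , α)) →
               Sweep bidPriority idAsk idBid (λ b → Tradable b α) α B (trades P B A (Sell , α))
  sell-sweep {B} {A} {α} legal = record
    { shape        = shape
    ; taker-capped = proj₂ (proj₂ (matching V legal)) α (here refl)
    ; maker-capped = proj₁ (proj₂ (matching V legal)) _
    ; prior        = proj₂ (priority B A (Sell , α) legal) _ _
    ; exhausted    = exhausted
    }
    where
    M = trades P B A (Sell , α)
    shape : ∀ {t} → t ∈ M → idAsk t ≡ id α × ∃[ b ] (b ∈ B × idBid t ≡ id b × Tradable b α)
    shape t∈ with proj₁ (matching V legal) _ t∈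
    ... | b , a , b∈ , here refl , b≡ , a≡ , b~a , _ = a≡ , b , b∈ , b≡ , b~a
    ... | b , a , b∈ , there a∈  , _  , _  , b~a , _ = contradiction (b , a , b∈ , a∈ , b~a) (proj₁ legal)
    exhausted : ∀ {b} → b ∈ B → Tradable b α → QtyBid M (id b) < qty b → QtyAsk M (id α) ≡ qty α
    exhausted b∈ b~α b-unfilled with m≤n⇒m<n∨m≡n (proj₂ (proj₂ (matching V legal)) α (here refl))
    ... | inj₁ α-unfilled = ⊥-elim (partial-fills-untradable V legal b∈ (here refl) b~α b-unfilled α-unfilled)
    ... | inj₂ α-filled   = α-filled

  -- Deleting an order from an unmatchable book leaves no tradable pair.
  del-no-trades : ∀ {B A ω} → LegalInput B A (Del , ω) → ∀ {t} → t ∉ trades P B A (Del , ω)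
  del-no-trades {B} {A} {ω} legal t∈ with proj₁ (matching V legal) _ t∈
  ... | b , a , b∈ , a∈ , _ , _ , b~a , _ =
    proj₁ legal (b , a , proj₁ (∈-filter⁻ (λ b → ¬? (id b ≟ id ω)) b∈) , proj₁ (∈-filter⁻ (λ a → ¬? (id a ≟ id ω)) a∈) , b~a)

record SameQuantities (M₁ M₂ : TransSet) : Set where
  field
    bid  : ∀ i → QtyBid M₁ i ≡ QtyBid M₂ i
    ask  : ∀ j → QtyAsk M₁ j ≡ QtyAsk M₂ j
    pair : ∀ i j → PairQty M₁ i j ≡ PairQty M₂ i j

no-trades-agree : ∀ {M₁ M₂} → (∀ {t} → t ∉ M₁) → (∀ {t} → t ∉ M₂) → SameQuantities M₁ M₂
no-trades-agree {M₁} {M₂} ∉M₁ ∉M₂ = record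
  { bid  = λ i → both-zero (λ t → idBid t ≟ i)
  ; ask  = λ j → both-zero (λ t → idAsk t ≟ j)
  ; pair = λ i j → both-zero (λ t → (idBid t ≟ i) ×-dec (idAsk t ≟ j))
  }
  where
  both-zero : ∀ {P : Pred Transaction 0ℓ} (P? : Decidable P) → TSum.filteredSum P? tqty M₁ ≡ TSum.filteredSum P? tqty M₂
  both-zero P? = trans (TSum.filteredSum-none P? tqty M₁ (λ _ t∈ _ → ∉M₁ t∈)) (sym (TSum.filteredSum-none P? tqty M₂ (λ _ t∈ _ → ∉M₂ t∈)))

absorb-≈ˢ : ∀ {B₁ A₁ B₂ A₂} τ → B₁ ≈ˢ B₂ → A₁ ≈ˢ A₂ →
            proj₁ (Absorb B₁ A₁ τ) ≈ˢ proj₁ (Absorb B₂ A₂ τ) × proj₂ (Absorb B₁ A₁ τ) ≈ˢ proj₂ (Absorb B₂ A₂ τ)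
absorb-≈ˢ (Del , ω)  B₁≈B₂ A₁≈A₂ = filter-≈ˢ (λ b → ¬? (id b ≟ id ω)) B₁≈B₂ , filter-≈ˢ (λ a → ¬? (id a ≟ id ω)) A₁≈A₂
absorb-≈ˢ (Buy , β)  B₁≈B₂ A₁≈A₂ = ∷-cong refl B₁≈B₂ , A₁≈A₂
absorb-≈ˢ (Sell , α) B₁≈B₂ A₁≈A₂ = B₁≈B₂ , ∷-cong refl A₁≈A₂

module _ {P₁ P₂ : Process} (V₁ : ValidProcess P₁) (V₂ : ValidProcess P₂)
         {B₁ A₁ B₂ A₂ : OrderSet} (B₁≈B₂ : B₁ ≈ˢ B₂) (A₁≈A₂ : A₁ ≈ˢ A₂) where

  trades-agree : ∀ τ → LegalInput B₁ A₁ τ → LegalInput B₂ A₂ τ → SameQuantities (trades P₁ B₁ A₁ τ) (trades P₂ B₂ A₂ τ)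
  trades-agree (Buy , β) legal₁ legal₂ = record { bid = proj₂ agree ; ask = proj₁ agree ; pair = pair≡ }
    where
    S₁ = buy-sweep V₁ legal₁
    S₂ = sweep-≈ˢ (≈ˢ.sym A₁≈A₂) (buy-sweep V₂ legal₂)
    adm = admissible-asks (proj₂ legal₁)
    agree = sweep-agree (admissible⇒id-unique adm) (admissible⇒ts-unique adm) S₁ S₂
    pair≡ : ∀ i j → PairQty (trades P₁ B₁ A₁ (Buy , β)) i j ≡ PairQty (trades P₂ B₂ A₂ (Buy , β)) i j
    pair≡ i j with i ≟ id β
    ... | yes refl = trans (pairQty-fixed-bid (proj₁ ∘ Sweep.shape S₁) j)
                     (trans (proj₁ agree j) (sym (pairQty-fixed-bid (proj₁ ∘ Sweep.shape S₂) j)))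
    ... | no i≢    = trans (pairQty-other-bid (proj₁ ∘ Sweep.shape S₁) j i≢)
                     (sym (pairQty-other-bid (proj₁ ∘ Sweep.shape S₂) j i≢))
  trades-agree (Sell , α) legal₁ legal₂ = record { bid = proj₁ agree ; ask = proj₂ agree ; pair = pair≡ }
    where
    S₁ = sell-sweep V₁ legal₁
    S₂ = sweep-≈ˢ (≈ˢ.sym B₁≈B₂) (sell-sweep V₂ legal₂)
    adm = admissible-bids (proj₂ legal₁)
    agree = sweep-agree (admissible⇒id-unique adm) (admissible⇒ts-unique adm) S₁ S₂
    pair≡ : ∀ i j → PairQty (trades P₁ B₁ A₁ (Sell , α)) i j ≡ PairQty (trades P₂ B₂ A₂ (Sell , α)) i j
    pair≡ i j with j ≟ id α
    ... | yes refl = trans (pairQty-fixed-ask (proj₁ ∘ Sweep.shape S₁) i)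
                     (trans (proj₁ agree i) (sym (pairQty-fixed-ask (proj₁ ∘ Sweep.shape S₂) i)))
    ... | no j≢    = trans (pairQty-other-ask (proj₁ ∘ Sweep.shape S₁) i j≢)
                     (sym (pairQty-other-ask (proj₁ ∘ Sweep.shape S₂) i j≢))
  trades-agree (Del , ω) legal₁ legal₂ = no-trades-agree (del-no-trades V₁ legal₁) (del-no-trades V₂ legal₂)

  step-agree : ∀ τ → LegalInput B₁ A₁ τ → LegalInput B₂ A₂ τ →
               (proj₁ (P₁ B₁ A₁ τ) ≈ˢ proj₁ (P₂ B₂ A₂ τ))
               × (proj₁ (proj₂ (P₁ B₁ A₁ τ)) ≈ˢ proj₁ (proj₂ (P₂ B₂ A₂ τ)))
               × (canonical (trades P₁ B₁ A₁ τ) ≈ˢ canonical (trades P₂ B₂ A₂ τ))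
  step-agree τ legal₁ legal₂ =
    ≈ˢ.trans (proj₁ (proj₂ c₁)) (≈ˢ.trans (−ᵐ-cong B'₁≈B'₂ (mult-≈ˢ bids≈)) (≈ˢ.sym (proj₁ (proj₂ c₂)))) ,
    ≈ˢ.trans (proj₂ (proj₂ c₁)) (≈ˢ.trans (−ᵐ-cong A'₁≈A'₂ (mult-≈ˢ asks≈)) (≈ˢ.sym (proj₂ (proj₂ c₂)))) ,
    canonical-cong M₁ M₂ (SameQuantities.pair same)
    where
    c₁ = ValidProcess.conservation V₁ B₁ A₁ τ legal₁
    c₂ = ValidProcess.conservation V₂ B₂ A₂ τ legal₂
    M₁ = trades P₁ B₁ A₁ τ
    M₂ = trades P₂ B₂ A₂ τ
    same = trades-agree τ legal₁ legal₂
    B'₁≈B'₂ = proj₁ (absorb-≈ˢ τ B₁≈B₂ A₁≈A₂)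
    A'₁≈A'₂ = proj₂ (absorb-≈ˢ τ B₁≈B₂ A₁≈A₂)
    bids≈ = tradedPart-≈ˢ (Bids-tradedPart M₁ _) (Bids-tradedPart M₂ _) B'₁≈B'₂ (SameQuantities.bid same)
    asks≈ = tradedPart-≈ˢ (Asks-tradedPart M₁ _) (Asks-tradedPart M₂ _) A'₁≈A'₂ (SameQuantities.ask same)

-- Reachable states of a structured order book

admissible-∷ : ∀ {L ω} → AdmissibleList L → (∀ {o} → o ∈ L → id o ≢ id ω × timestamp o ≢ timestamp ω) →
               AdmissibleList (ω ∷ L)
admissible-∷ adm fresh o o' (here refl) (here refl) o≢o' = contradiction refl o≢o'
admissible-∷ adm fresh o o' (here refl) (there o'∈) _    = let (id≢ , ts≢) = fresh o'∈ in id≢ ∘ sym , ts≢ ∘ sym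
admissible-∷ adm fresh o o' (there o∈)  (here refl) _    = fresh o∈
admissible-∷ adm fresh o o' (there o∈)  (there o'∈) o≢o' = adm o o' o∈ o'∈ o≢o'

admissible-by-keys : ∀ {L L'} → AdmissibleList L → (∀ {o} → o ∈ L' → ∃[ p ] (p ∈ L × key p ≡ key o)) →
                     (∀ {o o'} → o ∈ L' → o' ∈ L' → key o ≡ key o' → o ≡ o') → AdmissibleList L'
admissible-by-keys adm ancestor key-injective o o' o∈ o'∈ o≢o'
  with ancestor o∈ | ancestor o'∈
... | p , p∈ , refl | p' , p'∈ , refl with p ≟ᵒ p'
...   | yes refl = contradiction (key-injective o∈ o'∈ refl) o≢o'
...   | no p≢p'  = adm p p' p∈ p'∈ p≢p'

absorbed : OrderSet → OrderSet → Instruction → OrderSet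
absorbed B A τ = proj₁ (Absorb B A τ) ++ proj₂ (Absorb B A τ)

∈-absorbed-Del : ∀ {B A ω o} → o ∈ absorbed B A (Del , ω) → o ∈ B ++ A × id o ≢ id ω
∈-absorbed-Del {B} {A} {ω} o∈ with ∈-++⁻ (filter (λ b → ¬? (id b ≟ id ω)) B) o∈
... | inj₁ o∈B' = let (o∈B , id≢) = ∈-filter⁻ (λ b → ¬? (id b ≟ id ω)) {xs = B} o∈B' in ∈-++⁺ˡ o∈B , id≢
... | inj₂ o∈A' = let (o∈A , id≢) = ∈-filter⁻ (λ a → ¬? (id a ≟ id ω)) {xs = A} o∈A' in ∈-++⁺ʳ B o∈A , id≢

∈-absorbed : ∀ {B A o} τ → o ∈ absorbed B A τ → o ∈ B ++ A ⊎ o ≡ proj₂ τ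
∈-absorbed {B} {A} (Del , ω) o∈ = inj₁ (proj₁ (∈-absorbed-Del {B} {A} {ω} o∈))
∈-absorbed (Buy , β)  (here o≡β) = inj₂ o≡β
∈-absorbed (Buy , β)  (there o∈) = inj₁ o∈
∈-absorbed {B} {A} (Sell , α) o∈ with ∈-resp-↭ (shift α B A) o∈
... | here o≡α = inj₂ o≡α
... | there o∈ = inj₁ o∈

instructionIds : OrderBook → List ℕ
instructionIds I = map (λ τ → id (proj₂ τ)) I

instructionIds-take-suc : ∀ I k {τ} → nth I k ≡ just τ →
                          instructionIds (take (suc k) I) ≡ instructionIds (take k I) ++ id (proj₂ τ) ∷ []
instructionIds-take-suc (τ ∷ I) zero    refl = refl
instructionIds-take-suc (τ ∷ I) (suc k) nth≡ = cong (id (proj₂ τ) ∷_) (instructionIds-take-suc I k nth≡)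

record Invariant (I : OrderBook) (k : ℕ) (B A : OrderSet) : Set where
  field
    unmatchable : ¬ Matchable B A
    admissible  : Admissible B A
    ids-seen    : ∀ {o} → o ∈ B ++ A → id o ∈ instructionIds (take k I)
    older       : ∀ {o Δ ω} → o ∈ B ++ A → nth I k ≡ just (Δ , ω) → timestamp o < timestamp ω
    not-deleted : ∀ {j ω o} → k ≡ suc j → nth I j ≡ just (Del , ω) → o ∈ B ++ A → id o ≢ id ω

invariant-empty : ∀ I k → Invariant I k [] []
invariant-empty I k = record
  { unmatchable = λ { (_ , _ , () , _) }
  ; admissible  = λ _ _ ()
  ; ids-seen    = λ ()
  ; older       = λ ()
  ; not-deleted = λ _ _ ()
  }

module Reachable (I : OrderBook) (structured : Structured I) where

  fresh : ∀ {k B A Δ ω} → Invariant I k B A → nth I k ≡ just (Δ , ω) → Δ ≢ Del →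
          ∀ {o} → o ∈ B ++ A → id o ≢ id ω × timestamp o ≢ timestamp ω
  fresh {k} {Δ = Δ} {ω} inv nth≡ Δ≢Del {o} o∈ = id≢ , <⇒≢ (Invariant.older inv o∈ nth≡)
    where
    id≢ : id o ≢ id ω
    id≢ id≡ with proj₂ structured k Δ ω nth≡
    ... | inj₁ Δ≡Del = Δ≢Del Δ≡Del
    ... | inj₂ (inj₁ unseen) = unseen (subst (_∈ instructionIds (take k I)) id≡ (Invariant.ids-seen inv o∈))
    ... | inj₂ (inj₂ (j , ω' , refl , nth≡' , id≡')) = Invariant.not-deleted inv refl nth≡' o∈ (trans id≡ id≡')

  legal : ∀ {k B A τ} → Invariant I k B A → nth I k ≡ just τ → LegalInput B A τ
  legal {B = B} {A} {Del , ω}  inv nth≡ = Invariant.unmatchable inv ,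
    admissible-⊆ (Invariant.admissible inv) (λ o∈ → proj₁ (∈-absorbed-Del {B} {A} {ω} o∈))
  legal {B = B} {A} {Buy , β}  inv nth≡ = Invariant.unmatchable inv ,
    admissible-∷ (Invariant.admissible inv) (fresh inv nth≡ (λ ()))
  legal {B = B} {A} {Sell , α} inv nth≡ = Invariant.unmatchable inv ,
    admissible-⊆ (admissible-∷ (Invariant.admissible inv) (fresh inv nth≡ (λ ()))) (∈-resp-↭ (shift α B A))

  module _ {P : Process} (V : ValidProcess P) {k B A Δ ω} (inv : Invariant I k B A) (nth≡ : nth I k ≡ just (Δ , ω)) where
    private
      τ = Δ , ω
      lg = legal inv nth≡
      c = ValidProcess.conservation V B A τ lg
      B' = proj₁ (Absorb B A τ)
      A' = proj₂ (Absorb B A τ)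
      M  = trades P B A τ
      B̂  = proj₁ (P B A τ)
      Â  = proj₁ (proj₂ (P B A τ))
      B̂⊆ : B̂ ⊆ B' −ᵐ Bids M B'
      B̂⊆ = ≈ˢ⇒⊆ (proj₁ (proj₂ c))
      Â⊆ : Â ⊆ A' −ᵐ Asks M A'
      Â⊆ = ≈ˢ⇒⊆ (proj₂ (proj₂ c))

    ancestor : ∀ {o} → o ∈ B̂ ++ Â → ∃[ p ] (p ∈ absorbed B A τ × key p ≡ key o)
    ancestor o∈ with ∈-++⁻ B̂ o∈
    ... | inj₁ o∈B̂ = let (p , p∈ , k≡ , _) = ∈-−ᵐ⁻ B' _ (B̂⊆ o∈B̂) in p , ∈-++⁺ˡ p∈ , k≡
    ... | inj₂ o∈Â = let (p , p∈ , k≡ , _) = ∈-−ᵐ⁻ A' _ (Â⊆ o∈Â) in p , ∈-++⁺ʳ B' p∈ , k≡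

    -- A bid and an ask with the same key have the same price, so they cannot both remain.
    key-injective : ∀ {o o'} → o ∈ B̂ ++ Â → o' ∈ B̂ ++ Â → key o ≡ key o' → o ≡ o'
    key-injective {o} {o'} o∈ o'∈ k≡ with ∈-++⁻ B̂ o∈ | ∈-++⁻ B̂ o'∈
    ... | inj₁ o∈B̂ | inj₁ o'∈B̂ = −ᵐ-key-injective B' _ (B̂⊆ o∈B̂) (B̂⊆ o'∈B̂) k≡
    ... | inj₂ o∈Â | inj₂ o'∈Â = −ᵐ-key-injective A' _ (Â⊆ o∈Â) (Â⊆ o'∈Â) k≡
    ... | inj₁ o∈B̂ | inj₂ o'∈Â =
      contradiction (o , o' , o∈B̂ , o'∈Â , ≤-reflexive (cong (proj₂ ∘ proj₂) (sym k≡))) (ValidProcess.spread V B A τ lg)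
    ... | inj₂ o∈Â | inj₁ o'∈B̂ =
      contradiction (o' , o , o'∈B̂ , o∈Â , ≤-reflexive (cong (proj₂ ∘ proj₂) k≡)) (ValidProcess.spread V B A τ lg)

    invariant-step : Invariant I (suc k) B̂ Â
    invariant-step = record
      { unmatchable = ValidProcess.spread V B A τ lg
      ; admissible  = admissible-by-keys (proj₂ lg) ancestor key-injective
      ; ids-seen    = ids-seen
      ; older       = older
      ; not-deleted = not-deleted
      }
      where
      ids-seen : ∀ {o} → o ∈ B̂ ++ Â → id o ∈ instructionIds (take (suc k) I)
      ids-seen o∈ with ancestor o∈
      ... | p , p∈ , refl rewrite instructionIds-take-suc I k nth≡ with ∈-absorbed τ p∈
      ...   | inj₁ p∈old = ∈-++⁺ˡ (Invariant.ids-seen inv p∈old)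
      ...   | inj₂ refl  = ∈-++⁺ʳ _ (here refl)
      older : ∀ {o Δ' ω'} → o ∈ B̂ ++ Â → nth I (suc k) ≡ just (Δ' , ω') → timestamp o < timestamp ω'
      older o∈ nth≡' with ancestor o∈
      ... | p , p∈ , refl with ∈-absorbed τ p∈
      ...   | inj₁ p∈old = <-trans (Invariant.older inv p∈old nth≡) (proj₁ structured k Δ ω _ _ nth≡ nth≡')
      ...   | inj₂ refl  = proj₁ structured k Δ ω _ _ nth≡ nth≡'
      not-deleted : ∀ {j ω' o} → suc k ≡ suc j → nth I j ≡ just (Del , ω') → o ∈ B̂ ++ Â → id o ≢ id ω'
      not-deleted refl nth≡' o∈ with ancestor o∈ | trans (sym nth≡) nth≡'
      ... | p , p∈ , refl | refl = proj₂ (∈-absorbed-Del {B} {A} {ω} p∈)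

  iterated-invariant : ∀ {P} → ValidProcess P → ∀ k → Invariant I k (proj₁ (Iterated P I k)) (proj₁ (proj₂ (Iterated P I k)))
  iterated-invariant V zero = invariant-empty I zero
  iterated-invariant V (suc k) with nth I k in nth≡
  ... | nothing      = invariant-empty I (suc k)
  ... | just (Δ , ω) = invariant-step V (iterated-invariant V k) nth≡

theorem2 : (P₁ P₂ : Process) →
    PositiveBidAskSpread P₁ → PriceTimePriority P₁ → Conservation P₁ →
    PositiveBidAskSpread P₂ → PriceTimePriority P₂ → Conservation P₂ →
    (I : OrderBook) → Structured I → (k : ℕ) →
    (proj₁ (Iterated P₁ I k) ≈ˢ proj₁ (Iterated P₂ I k))
    × (proj₁ (proj₂ (Iterated P₁ I k)) ≈ˢ proj₁ (proj₂ (Iterated P₂ I k)))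
    × (canonical (proj₂ (proj₂ (Iterated P₁ I k))) ≈ˢ canonical (proj₂ (proj₂ (Iterated P₂ I k))))
theorem2 P₁ P₂ spr₁ pri₁ con₁ spr₂ pri₂ con₂ I structured zero = ≈ˢ.refl , ≈ˢ.refl , ≈ˢ.refl
theorem2 P₁ P₂ spr₁ pri₁ con₁ spr₂ pri₂ con₂ I structured (suc k) with nth I k in nth≡
... | nothing = ≈ˢ.refl , ≈ˢ.refl , ≈ˢ.refl
... | just τ  = step-agree V₁ V₂ B₁≈B₂ A₁≈A₂ τ (legal (iterated-invariant V₁ k) nth≡) (legal (iterated-invariant V₂ k) nth≡)
  where
  open Reachable I structured
  V₁ : ValidProcess P₁
  V₁ = record { spread = spr₁ ; priority = pri₁ ; conservation = con₁ }
  V₂ : ValidProcess P₂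
  V₂ = record { spread = spr₂ ; priority = pri₂ ; conservation = con₂ }
  B₁≈B₂ = proj₁ (theorem2 P₁ P₂ spr₁ pri₁ con₁ spr₂ pri₂ con₂ I structured k)
  A₁≈A₂ = proj₁ (proj₂ (theorem2 P₁ P₂ spr₁ pri₁ con₁ spr₂ pri₂ con₂ I structured k))
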